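{- Let $G$ be a connected $(2K_2, HVN)$-free graph. Then either $G$ is $(2K_2, \text{diamond})$-free, or there exists a partition $(V_1, V_2, V_3, V_4)$ of $V(G)$ such that (i) $V_1$ induces a $(2K_2, \text{paw})$-free subgraph $G[V_1]$ with $\omega(G[V_1]) \leq \omega(G)-1$, and (ii) $V_i$ is an independent set for each $i\in\{2,3,4\}$.
   Context: All graphs are finite, simple and undirected. $2K_2$ is the disjoint union of two edges. The diamond ($K_4-e$) is the graph on $\{a,b,c,d\}$ with edges $ab,bc,cd,ad,bd$. The paw is the graph on $\{a,b,c,d\}$ with edges $ab,bc,ac,ad$. $HVN$ is the graph obtained from $K_4$ by adding one new vertex adjacent to exactly two vertices of the $K_4$. A graph is $\mathcal{F}$-free if it has no induced subgraph isomorphic to a member of $\mathcal{F}$. $G[S]$ is the induced subgraph on $S$; $\omega$ is the clique number. -}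

module Defs where

open import Data.Nat using (ℕ; zero; suc; _≤_; _∸_; _≟_)
open import Data.Fin using (Fin; toℕ)
open import Data.Bool using (Bool; true; false; _∧_; _∨_)
open import Data.List using (List; []; _∷_)
open import Data.Bool.ListAction using (any)
open import Data.Product using (Σ; _×_; _,_; ∃)
open import Relation.Binary.PropositionalEquality using (_≡_; _≢_)
open import Relation.Nullary using (¬_)
open import Relation.Nullary.Decidable using (⌊_⌋)
open import Function.Definitions using (Injective)

record Graph : Set where
  field
    n      : ℕ
    adj    : Fin n → Fin n → Bool
    sym    : ∀ u v → adj u v ≡ adj v u
    irrefl : ∀ v → adj v v ≡ false
open Graph public

VSet : Graph → Set₁
VSet G = Fin (n G) → Set

data Walk (G : Graph) : Fin (n G) → Fin (n G) → Set where
  here : ∀ {v} → Walk G v v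
  step : ∀ {u v w} → adj G u v ≡ true → Walk G v w → Walk G u w

Connected : Graph → Set
Connected G = ∀ u v → Walk G u v

Pattern : Set
Pattern = Σ ℕ (λ k → List (ℕ × ℕ))

pk : Pattern → ℕ
pk (k , _) = k

padj : (H : Pattern) → Fin (pk H) → Fin (pk H) → Bool
padj (k , es) i j = any (λ { (a , b) →
   (⌊ a ≟ toℕ i ⌋ ∧ ⌊ b ≟ toℕ j ⌋) ∨ (⌊ a ≟ toℕ j ⌋ ∧ ⌊ b ≟ toℕ i ⌋) }) es

twoK2 : Pattern
twoK2 = 4 , ((0 , 1) ∷ (2 , 3) ∷ [])

diamond : Pattern
diamond = 4 , ((0 , 1) ∷ (1 , 2) ∷ (2 , 3) ∷ (0 , 3) ∷ (1 , 3) ∷ [])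

paw : Pattern
paw = 4 , ((0 , 1) ∷ (1 , 2) ∷ (0 , 2) ∷ (0 , 3) ∷ [])

-- HVN : K4 on 0..3 plus vertex 4 adjacent to 0 and 1
HVN : Pattern
HVN = 5 , ((0 , 1) ∷ (0 , 2) ∷ (0 , 3) ∷ (1 , 2) ∷ (1 , 3) ∷ (2 , 3)
          ∷ (4 , 0) ∷ (4 , 1) ∷ [])

InducedIn : (G : Graph) → VSet G → Pattern → Set
InducedIn G S H = Σ (Fin (pk H) → Fin (n G)) λ f →
  Injective _≡_ _≡_ f × (∀ i → S (f i)) ×
  (∀ i j → i ≢ j → adj G (f i) (f j) ≡ padj H i j)

FreeIn : (G : Graph) → VSet G → Pattern → Set
FreeIn G S H = ¬ InducedIn G S H

Everything : (G : Graph) → VSet G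
Everything G _ = Data.Unit.⊤
  where import Data.Unit

Free : Graph → Pattern → Set
Free G H = FreeIn G (Everything G) H

CliqueIn : (G : Graph) → VSet G → ℕ → Set
CliqueIn G S k = Σ (Fin k → Fin (n G)) λ f →
  Injective _≡_ _≡_ f × (∀ i → S (f i)) ×
  (∀ i j → i ≢ j → adj G (f i) (f j) ≡ true)

IsCliqueNumberIn : (G : Graph) → VSet G → ℕ → Set
IsCliqueNumberIn G S w = CliqueIn G S w × (∀ k → CliqueIn G S k → k ≤ w)

IsCliqueNumber : Graph → ℕ → Set
IsCliqueNumber G w = IsCliqueNumberIn G (Everything G) w

Independent : (G : Graph) → VSet G → Set
Independent G S = ∀ u v → S u → S v → adj G u v ≡ false

-- If G has no triangle it is diamond-free.  If G has a triangle a b d but no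
-- K4, the neighbourhood of a is triangle-free, hence paw-free and of smaller
-- clique number, and 2K2-freeness splits the non-neighbours of a into three
-- independent sets according to their adjacency to b and d.  If G has a K4,
-- take a clique q₀ … q_m with m ≥ 3 in which no vertex can be traded for two,
-- and let A_i be the set of vertices adjacent to every q_j with j ≠ i.  Each
-- A_i is independent; HVN-freeness makes vertices of different A_i adjacent and
-- lets a vertex outside every A_i see at most one q_j.  So the union of the A_i
-- with i ≠ 0 is complete multipartite inside the neighbourhood of q₀, A_0 is
-- independent, and the remaining vertices are independent by 2K2-freeness.
module Submission where

open import Defs hiding (sym)
open import Data.Bool using (Bool; true; false; _∧_; _∨_)
open import Data.Bool.Properties using (∨-comm; not-¬; ¬-not)
import Data.Bool.Properties as Bool
open import Data.Empty using (⊥; ⊥-elim)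
open import Data.Fin using (Fin; zero; suc; toℕ)
open import Data.Fin.Patterns using (0F; 1F; 2F; 3F)
import Data.Fin.Properties as Fin
open import Data.List using (List; []; _∷_; length; filter; cartesianProduct; allFin)
open import Data.List.Membership.Propositional using (_∈_)
open import Data.List.Membership.Propositional.Properties
  using (∈-filter⁺; ∈-cartesianProduct⁺; ∈-allFin)
open import Data.List.Membership.Setoid.Properties using (index-injective)
open import Data.List.Relation.Unary.All as All using (All; []; _∷_)
open import Data.List.Relation.Unary.All.Properties using (¬Any⇒All¬)
open import Data.List.Relation.Unary.Any using (any?; index)
open import Data.Nat using (ℕ; zero; suc; _+_; _∸_; _≤_; _<_; s≤s; _≟_)
open import Data.Nat.Properties using (<⇒≱; <⇒≤; ≤-refl; m≤m+n; m≤n⇒m≤1+n; +-suc)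
open import Data.Product using (Σ; ∃; ∃₂; _×_; _,_; uncurry)
open import Data.Sum using (_⊎_; inj₁; inj₂)
open import Data.Unit using (tt)
open import Data.Vec using ([]; _∷_)
import Data.Vec as Vec
open import Data.Vec.Functional using (updateAt)
open import Data.Vec.Functional.Properties using (updateAt-updates; updateAt-minimal)
open import Function using (const; _∘_)
open import Function.Definitions using (Injective)
open import Relation.Binary using (tri<; tri≈; tri>)
open import Relation.Binary.PropositionalEquality
  using (_≡_; _≢_; refl; sym; trans; cong; cong₂; subst; setoid; ≢-sym)
open import Relation.Nullary using (¬_; Dec; yes; no; ¬?; contradiction)
open import Relation.Nullary.Decidable using (⌊_⌋; _×-dec_; _⊎-dec_; _→-dec_; from-yes)

fresh : ∀ {m} (xs : List (Fin m)) → length xs < m → ∃ λ s → All (s ≢_) xs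
fresh {m} xs length<m with Fin.all? (λ s → any? (s Fin.≟_) xs)
... | yes all∈ = contradiction
      (Fin.injective⇒≤ {f = λ s → index (all∈ s)}
                       λ {s} {t} → index-injective (setoid (Fin m)) (all∈ s) (all∈ t))
      (<⇒≱ length<m)
... | no ¬all∈ with Fin.¬∀⟶∃¬ m (_∈ xs) (λ s → any? (s Fin.≟_) xs) ¬all∈
...   | s , s∉xs = s , ¬Any⇒All¬ xs s∉xs

-- In lexicographic order, which fixes the order of the hypotheses in twoK2-copy,
-- HVN-copy and K4⇒clique.
orderedPairs : ∀ k → List (Fin k × Fin k)
orderedPairs k = filter (uncurry Fin._<?_) (cartesianProduct (allFin k) (allFin k))

∈-orderedPairs : ∀ {k} {i j : Fin k} → toℕ i < toℕ j → (i , j) ∈ orderedPairs k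
∈-orderedPairs {i = i} {j} i<j =
  ∈-filter⁺ (uncurry Fin._<?_) (∈-cartesianProduct⁺ (∈-allFin i) (∈-allFin j)) i<j

fromOrderedPairs : ∀ {k ℓ} {R : Fin k → Fin k → Set ℓ} → (∀ {i j} → R i j → R j i) →
  All (uncurry R) (orderedPairs k) → ∀ i j → i ≢ j → R i j
fromOrderedPairs R-sym R-pairs i j i≢j with Fin.<-cmp i j
... | tri< i<j _ _ = All.lookup R-pairs (∈-orderedPairs i<j)
... | tri≈ _ i≡j _ = contradiction i≡j i≢j
... | tri> _ _ j<i = R-sym (All.lookup R-pairs (∈-orderedPairs j<i))

padj-sym : ∀ (H : Pattern) i j → padj H i j ≡ padj H j i
padj-sym (k , []) i j = refl
padj-sym (k , (a , b) ∷ es) i j =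
  cong₂ _∨_ (∨-comm (⌊ a ≟ toℕ i ⌋ ∧ ⌊ b ≟ toℕ j ⌋)
                    (⌊ a ≟ toℕ j ⌋ ∧ ⌊ b ≟ toℕ i ⌋))
            (padj-sym (k , es) i j)

-- Guarantees that every adjacency-preserving map out of the pattern is injective.
FalseTwinFree : Pattern → Set
FalseTwinFree H = ∀ i j → i ≢ j →
  padj H i j ≡ true ⊎ ∃ λ w → w ≢ i × w ≢ j × padj H w i ≢ padj H w j

falseTwinFree? : ∀ H → Dec (FalseTwinFree H)
falseTwinFree? H = Fin.all? λ i → Fin.all? λ j → ¬? (i Fin.≟ j) →-dec
  (padj H i j Bool.≟ true ⊎-dec Fin.any? λ w →
     ¬? (w Fin.≟ i) ×-dec ¬? (w Fin.≟ j) ×-dec ¬? (padj H w i Bool.≟ padj H w j))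

twoK2-falseTwinFree : FalseTwinFree twoK2
twoK2-falseTwinFree = from-yes (falseTwinFree? twoK2)

HVN-falseTwinFree : FalseTwinFree HVN
HVN-falseTwinFree = from-yes (falseTwinFree? HVN)

Decomposition : Graph → Set
Decomposition G = Σ (Fin (n G) → Fin 4) (λ p →
  (FreeIn G (λ v → p v ≡ 0F) twoK2 ×
   FreeIn G (λ v → p v ≡ 0F) paw ×
   (∀ w1 w → IsCliqueNumberIn G (λ v → p v ≡ 0F) w1 →
      IsCliqueNumber G w → w1 ≤ w ∸ 1)) ×
  (∀ (i : Fin 4) → i ≢ 0F → Independent G (λ v → p v ≡ i)))

module _ (G : Graph) where
  private
    V = Fin (n G)
    E = adj G

  adj-sym : ∀ {u v b} → E u v ≡ b → E v u ≡ b
  adj-sym {u} {v} uv = trans (Graph.sym G v u) uv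

  adj⇒≢ : ∀ {u v} → E u v ≡ true → u ≢ v
  adj⇒≢ {u} uv refl = not-¬ uv (irrefl G u)

  Realises : (H : Pattern) → (Fin (pk H) → V) → Set
  Realises H f = All (uncurry λ i j → E (f i) (f j) ≡ padj H i j) (orderedPairs (pk H))

  inducedCopy : (H : Pattern) → FalseTwinFree H → (f : Fin (pk H) → V) → Realises H f →
    InducedIn G (Everything G) H
  inducedCopy H twinFree f realises = f , injective , (λ _ → tt) , adjacency
    where
    adjacency : ∀ i j → i ≢ j → E (f i) (f j) ≡ padj H i j
    adjacency = fromOrderedPairs
      (λ {i} {j} fij → trans (Graph.sym G (f j) (f i)) (trans fij (padj-sym H i j))) realises
    injective : Injective _≡_ _≡_ f
    injective {i} {j} fi≡fj with i Fin.≟ j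
    ... | yes i≡j = i≡j
    ... | no i≢j with twinFree i j i≢j
    ...   | inj₁ ij = contradiction fi≡fj (adj⇒≢ (trans (adjacency i j i≢j) ij))
    ...   | inj₂ (w , w≢i , w≢j , wi≢wj) = contradiction
            (trans (sym (adjacency w i w≢i)) (trans (cong (E (f w)) fi≡fj) (adjacency w j w≢j)))
            wi≢wj

  twoK2-copy : ∀ {x y u v} → E x y ≡ true → E u v ≡ true →
    E x u ≡ false → E x v ≡ false → E y u ≡ false → E y v ≡ false →
    InducedIn G (Everything G) twoK2
  twoK2-copy {x} {y} {u} {v} xy uv xu xv yu yv =
    inducedCopy twoK2 twoK2-falseTwinFree (Vec.lookup (x ∷ y ∷ u ∷ v ∷ []))
      (xy ∷ xu ∷ xv ∷ yu ∷ yv ∷ uv ∷ [])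

  HVN-copy : ∀ {a b c d z} →
    E a b ≡ true → E a c ≡ true → E a d ≡ true → E b c ≡ true → E b d ≡ true → E c d ≡ true →
    E z a ≡ true → E z b ≡ true → E z c ≡ false → E z d ≡ false →
    InducedIn G (Everything G) HVN
  HVN-copy {a} {b} {c} {d} {z} ab ac ad bc bd cd za zb zc zd =
    inducedCopy HVN HVN-falseTwinFree (Vec.lookup (a ∷ b ∷ c ∷ d ∷ z ∷ []))
      (ab ∷ ac ∷ ad ∷ adj-sym za ∷ bc ∷ bd ∷ adj-sym zb ∷ cd ∷ adj-sym zc ∷ adj-sym zd ∷ [])

  free⇒freeIn : ∀ {H} (S : VSet G) → Free G H → FreeIn G S H
  free⇒freeIn S H-free (f , f-injective , _ , f-adj) =
    H-free (f , f-injective , (λ _ → tt) , f-adj)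

  record Clique (m : ℕ) : Set where
    constructor clique
    field
      vertex   : Fin m → V
      adjacent : ∀ i j → i ≢ j → E (vertex i) (vertex j) ≡ true

  open Clique public

  vertex-injective : ∀ {m} (C : Clique m) → Injective _≡_ _≡_ (vertex C)
  vertex-injective C {i} {j} vi≡vj with i Fin.≟ j
  ... | yes i≡j = i≡j
  ... | no i≢j = contradiction vi≡vj (adj⇒≢ (adjacent C i j i≢j))

  clique-size≤order : ∀ {m} → Clique m → m ≤ n G
  clique-size≤order C = Fin.injective⇒≤ (vertex-injective C)

  cone : ∀ {m} (a : V) (C : Clique m) → (∀ i → E (vertex C i) a ≡ true) → Clique (suc m)
  cone {m} a C C-sees-a = clique apex-vertex apex-adjacent
    where
    apex-vertex : Fin (suc m) → V
    apex-vertex zero    = a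
    apex-vertex (suc i) = vertex C i
    apex-adjacent : ∀ i j → i ≢ j → E (apex-vertex i) (apex-vertex j) ≡ true
    apex-adjacent zero    zero    0≢0   = contradiction refl 0≢0
    apex-adjacent zero    (suc j) _     = adj-sym (C-sees-a j)
    apex-adjacent (suc i) zero    _     = C-sees-a i
    apex-adjacent (suc i) (suc j) si≢sj = adjacent C i j (si≢sj ∘ cong suc)

  clique⇒cliqueIn : ∀ {k} → Clique k → CliqueIn G (Everything G) k
  clique⇒cliqueIn C = vertex C , vertex-injective C , (λ _ → tt) , adjacent C

  ω-inNeighbourhood≤ω∸1 : (a : V) (S : VSet G) → (∀ v → S v → E v a ≡ true) →
    ∀ w₁ w → IsCliqueNumberIn G S w₁ → IsCliqueNumber G w → w₁ ≤ w ∸ 1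
  ω-inNeighbourhood≤ω∸1 a S S-sees-a w₁ w ((f , _ , f∈S , f-adj) , _) (_ , ω-maximal)
    with ω-maximal (suc w₁)
           (clique⇒cliqueIn (cone a (clique f f-adj) (λ i → S-sees-a (f i) (f∈S i))))
  ... | s≤s w₁≤w∸1 = w₁≤w∸1

  SeesAllBut : ∀ {m} → Clique m → Fin m → V → Set
  SeesAllBut C i x = ∀ j → j ≢ i → E x (vertex C j) ≡ true

  seesAllBut? : ∀ {m} (C : Clique m) i x → Dec (SeesAllBut C i x)
  seesAllBut? C i x = Fin.all? λ j → ¬? (j Fin.≟ i) →-dec E x (vertex C j) Bool.≟ true

  -- Two adjacent vertices that both see all of C but its i-th vertex replace
  -- that vertex and enlarge C.
  Augmentable : ∀ {m} → Clique m → Set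
  Augmentable {m} C = ∃ λ i → ∃₂ λ x y →
    SeesAllBut C i x × SeesAllBut C i y × E x y ≡ true

  augmentable? : ∀ {m} (C : Clique m) → Dec (Augmentable C)
  augmentable? C = Fin.any? λ i → Fin.any? λ x → Fin.any? λ y →
    seesAllBut? C i x ×-dec seesAllBut? C i y ×-dec E x y Bool.≟ true

  augment : ∀ {m} (C : Clique m) → Augmentable C → Clique (suc m)
  augment C (i , x , y , x-sees , y-sees , xy) =
    cone y (clique swapped swapped-adjacent) y-sees-swapped
    where
    swapped : Fin _ → V
    swapped = updateAt (vertex C) i (const x)
    swapped-at-i : swapped i ≡ x
    swapped-at-i = updateAt-updates i (vertex C)
    swapped-elsewhere : ∀ {j} → j ≢ i → swapped j ≡ vertex C j
    swapped-elsewhere {j} j≢i = updateAt-minimal j i (vertex C) j≢i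
    swapped-adjacent : ∀ j k → j ≢ k → E (swapped j) (swapped k) ≡ true
    swapped-adjacent j k j≢k with j Fin.≟ i | k Fin.≟ i
    ... | yes refl | yes refl = contradiction refl j≢k
    ... | yes refl | no k≢i rewrite swapped-at-i | swapped-elsewhere k≢i = x-sees k k≢i
    ... | no j≢i | yes refl rewrite swapped-at-i | swapped-elsewhere j≢i = adj-sym (x-sees j j≢i)
    ... | no j≢i | no k≢i rewrite swapped-elsewhere j≢i | swapped-elsewhere k≢i = adjacent C j k j≢k
    y-sees-swapped : ∀ j → E (swapped j) y ≡ true
    y-sees-swapped j with j Fin.≟ i
    ... | yes refl rewrite swapped-at-i = xy
    ... | no j≢i rewrite swapped-elsewhere j≢i = adj-sym (y-sees j j≢i)

  NonAugmentableClique : ℕ → Set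
  NonAugmentableClique m = Σ (Clique m) λ C → ¬ Augmentable C

  extendToNonAugmentable : ∀ {m} → Clique m → ∃ λ m′ → m ≤ m′ × NonAugmentableClique m′
  extendToNonAugmentable {m} = go (suc (n G)) (s≤s (m≤m+n (n G) m))
    where
    go : ∀ fuel {k} → n G < fuel + k → Clique k → ∃ λ k′ → k ≤ k′ × NonAugmentableClique k′
    go zero       bound C = contradiction (clique-size≤order C) (<⇒≱ bound)
    go (suc fuel) {k} bound C with augmentable? C
    ... | no ¬augmentable = k , ≤-refl , C , ¬augmentable
    ... | yes augmentable
      with go fuel (subst (n G <_) (sym (+-suc fuel k)) bound) (augment C augmentable)
    ...   | k′ , k<k′ , C′ = k′ , <⇒≤ k<k′ , C′

  Triangle : Set
  Triangle = Σ V λ a → Σ V λ b → Σ V λ c → E a b ≡ true × E a c ≡ true × E b c ≡ true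

  K4 : Set
  K4 = Σ V λ a → Σ V λ b → Σ V λ c → Σ V λ d →
    E a b ≡ true × E a c ≡ true × E a d ≡ true × E b c ≡ true × E b d ≡ true × E c d ≡ true

  triangle? : Dec Triangle
  triangle? = Fin.any? λ a → Fin.any? λ b → Fin.any? λ c →
    E a b Bool.≟ true ×-dec E a c Bool.≟ true ×-dec E b c Bool.≟ true

  K4? : Dec K4
  K4? = Fin.any? λ a → Fin.any? λ b → Fin.any? λ c → Fin.any? λ d →
    E a b Bool.≟ true ×-dec E a c Bool.≟ true ×-dec E a d Bool.≟ true ×-dec
    E b c Bool.≟ true ×-dec E b d Bool.≟ true ×-dec E c d Bool.≟ true

  K4⇒clique : K4 → Clique 4
  K4⇒clique (a , b , c , d , ab , ac , ad , bc , bd , cd) =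
    clique (Vec.lookup (a ∷ b ∷ c ∷ d ∷ []))
           (fromOrderedPairs adj-sym (ab ∷ ac ∷ ad ∷ bc ∷ bd ∷ cd ∷ []))

  triangle-free⇒diamond-free : ¬ Triangle → Free G diamond
  triangle-free⇒diamond-free ¬triangle (f , _ , _ , f-adj) =
    ¬triangle (f 0F , f 1F , f 3F , f-adj 0F 1F (λ ()) , f-adj 0F 3F (λ ()) , f-adj 1F 3F (λ ()))

  K4-free⇒neighbourhood-paw-free : ¬ K4 → (a : V) (S : VSet G) → (∀ v → S v → E v a ≡ true) →
    FreeIn G S paw
  K4-free⇒neighbourhood-paw-free ¬K4 a S S-sees-a (f , _ , f∈S , f-adj) =
    ¬K4 (a , f 0F , f 1F , f 2F , adj-sym (S-sees-a _ (f∈S 0F)) , adj-sym (S-sees-a _ (f∈S 1F)) ,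
         adj-sym (S-sees-a _ (f∈S 2F)) , f-adj 0F 1F (λ ()) , f-adj 0F 2F (λ ()) , f-adj 1F 2F (λ ()))

  -- Non-adjacency being transitive makes G[S] complete multipartite; the paw
  -- has the non-edges 13 and 23 but the edge 12.
  nonadjacency-transitive⇒paw-free : (S : VSet G) →
    (∀ {x y z} → S x → S y → S z → E x z ≡ false → E z y ≡ false → E x y ≡ false) →
    FreeIn G S paw
  nonadjacency-transitive⇒paw-free S transitive (f , _ , f∈S , f-adj) =
    not-¬ (f-adj 1F 2F (λ ()))
      (transitive (f∈S 1F) (f∈S 2F) (f∈S 3F) (f-adj 1F 3F (λ ())) (f-adj 3F 2F (λ ())))

  decomposition : Free G twoK2 → (p : V → Fin 4) (a : V) →
    (∀ v → p v ≡ 0F → E v a ≡ true) → FreeIn G (λ v → p v ≡ 0F) paw →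
    (∀ i → i ≢ 0F → Independent G (λ v → p v ≡ i)) → Decomposition G
  decomposition twoK2-free p a part₀-sees-a part₀-paw-free independent =
    p , (free⇒freeIn {twoK2} (λ v → p v ≡ 0F) twoK2-free , part₀-paw-free ,
         ω-inNeighbourhood≤ω∸1 a _ part₀-sees-a) ,
    independent

  module K4FreeCase (twoK2-free : Free G twoK2) (¬K4 : ¬ K4) {a b d : V}
    (ab : E a b ≡ true) (ad : E a d ≡ true) (bd : E b d ≡ true) where

    classify : Bool → Bool → Bool → Fin 4
    classify true  _     _     = 0F
    classify false _     false = 2F
    classify false true  true  = 1F
    classify false false true  = 3F

    part : V → Fin 4
    part x = classify (E x a) (E x b) (E x d)

    InPart : Fin 4 → V → Set
    InPart 0F x = E x a ≡ true
    InPart 1F x = E x b ≡ true × E x d ≡ true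
    InPart 2F x = E x a ≡ false × E x d ≡ false
    InPart 3F x = E x a ≡ false × E x b ≡ false

    classify-sound : ∀ x → InPart (classify (E x a) (E x b) (E x d)) x
    classify-sound x with E x a in xa | E x b in xb | E x d in xd
    ... | true  | _     | _     = xa
    ... | false | _     | false = xa , xd
    ... | false | true  | true  = xb , xd
    ... | false | false | true  = xa , xb

    inPart : ∀ {x k} → part x ≡ k → InPart k x
    inPart {x} refl = classify-sound x

    independent : ∀ i → i ≢ 0F → Independent G (λ v → part v ≡ i)
    independent 0F 0≢0 = contradiction refl 0≢0
    independent 1F _ x y x∈ y∈ = ¬-not λ xy →
      let xb , xd = inPart x∈; yb , yd = inPart y∈
      in ¬K4 (x , y , b , d , xy , xb , xd , yb , yd , bd)
    independent 2F _ x y x∈ y∈ = ¬-not λ xy →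
      let xa , xd = inPart x∈; ya , yd = inPart y∈
      in twoK2-free (twoK2-copy xy ad xa xd ya yd)
    independent 3F _ x y x∈ y∈ = ¬-not λ xy →
      let xa , xb = inPart x∈; ya , yb = inPart y∈
      in twoK2-free (twoK2-copy xy ab xa xb ya yb)

    result : Decomposition G
    result = decomposition twoK2-free part a (λ _ → inPart)
      (K4-free⇒neighbourhood-paw-free ¬K4 a _ (λ _ → inPart)) independent

  module CliqueCase (twoK2-free : Free G twoK2) (HVN-free : Free G HVN)
    {m} (3≤m : 3 ≤ m) (C : Clique (suc m)) (¬augmentable : ¬ Augmentable C) where

    private
      q = vertex C
      q-adjacent = adjacent C

    seesAllBut-independent : ∀ {i x y} → SeesAllBut C i x → SeesAllBut C i y → E x y ≡ false
    seesAllBut-independent {i} {x} {y} x-sees y-sees =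
      ¬-not λ xy → ¬augmentable (i , x , y , x-sees , y-sees , xy)

    seesAllBut-self : ∀ i → SeesAllBut C i (q i)
    seesAllBut-self i j j≢i = q-adjacent i j (≢-sym j≢i)

    misses-some : ∀ x → ∃ λ j → E x (q j) ≡ false
    misses-some x with Fin.any? (λ j → E x (q j) Bool.≟ false)
    ... | yes misses = misses
    ... | no ¬misses =
          ⊥-elim (not-¬ (sees zero) (seesAllBut-independent (λ j _ → sees j) (seesAllBut-self zero)))
      where
      sees : ∀ j → E x (q j) ≡ true
      sees j = ¬-not λ xj → ¬misses (j , xj)

    misses-own : ∀ {i x} → SeesAllBut C i x → E x (q i) ≡ false
    misses-own {i} {x} x-sees with misses-some x
    ... | j , xj with j Fin.≟ i
    ...   | yes refl = xj
    ...   | no j≢i   = ⊥-elim (not-¬ (x-sees j j≢i) xj)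

    private
      2<1+m : 2 < suc m
      2<1+m = m≤n⇒m≤1+n 3≤m
      3<1+m : 3 < suc m
      3<1+m = s≤s 3≤m

    -- Otherwise, for two further indices s and t, y sees exactly q s and q t of
    -- the K4 {q s, q t, x, q j}.
    nonadjacent⇒same-index : ∀ {i j x y} → SeesAllBut C i x → SeesAllBut C j y →
      E x y ≡ false → i ≡ j
    nonadjacent⇒same-index {i} {j} x-sees y-sees xy with i Fin.≟ j
    ... | yes i≡j = i≡j
    ... | no i≢j with fresh (i ∷ j ∷ []) 2<1+m
    ...   | s , s≢i ∷ s≢j ∷ [] with fresh (i ∷ j ∷ s ∷ []) 3<1+m
    ...     | t , t≢i ∷ t≢j ∷ t≢s ∷ [] = ⊥-elim (HVN-free (HVN-copy
              (q-adjacent s t (≢-sym t≢s)) (adj-sym (x-sees s s≢i)) (q-adjacent s j s≢j)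
              (adj-sym (x-sees t t≢i)) (q-adjacent t j t≢j) (x-sees j (≢-sym i≢j))
              (y-sees s s≢j) (y-sees t t≢j) (adj-sym xy) (misses-own y-sees)))

    private
      seen≢missed : ∀ {x k j} → E x (q k) ≡ true → E x (q j) ≡ false → k ≢ j
      seen≢missed xk xj refl = not-¬ xk xj

    misses-two : ∀ {x} → (∀ i → ¬ SeesAllBut C i x) →
      ∃₂ λ j₁ j₂ → j₁ ≢ j₂ × E x (q j₁) ≡ false × E x (q j₂) ≡ false
    misses-two {x} x-outside with misses-some x
    ... | j₁ , xj₁ with Fin.¬∀⟶∃¬ _ (λ j → j ≢ j₁ → E x (q j) ≡ true)
                          (λ j → ¬? (j Fin.≟ j₁) →-dec E x (q j) Bool.≟ true) (x-outside j₁)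
    ...   | j₂ , ¬sees-j₂ =
            j₁ , j₂ , (λ j₁≡j₂ → ¬sees-j₂ λ j₂≢j₁ → ⊥-elim (j₂≢j₁ (sym j₁≡j₂))) ,
            xj₁ , ¬-not (λ xj₂ → ¬sees-j₂ λ _ → xj₂)

    -- Two neighbours q k, q j of x in C together with two non-neighbours form
    -- a K4 meeting x in exactly two vertices.
    sees-at-most-one : ∀ {x} → (∀ i → ¬ SeesAllBut C i x) →
      ∃ λ k → ∀ j → j ≢ k → E x (q j) ≡ false
    sees-at-most-one {x} x-outside with Fin.any? (λ k → E x (q k) Bool.≟ true)
    ... | no ¬sees = zero , λ j _ → ¬-not λ xj → ¬sees (j , xj)
    ... | yes (k , xk) with misses-two x-outside
    ...   | j₁ , j₂ , j₁≢j₂ , xj₁ , xj₂ = k , λ j j≢k → ¬-not λ xj → HVN-free (HVN-copy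
            (q-adjacent k j (≢-sym j≢k)) (q-adjacent k j₁ (seen≢missed xk xj₁))
            (q-adjacent k j₂ (seen≢missed xk xj₂)) (q-adjacent j j₁ (seen≢missed xj xj₁))
            (q-adjacent j j₂ (seen≢missed xj xj₂)) (q-adjacent j₁ j₂ j₁≢j₂) xk xj xj₁ xj₂)

    outside-independent : ∀ {x y} → (∀ i → ¬ SeesAllBut C i x) → (∀ i → ¬ SeesAllBut C i y) →
      E x y ≡ false
    outside-independent x-outside y-outside
      with sees-at-most-one x-outside | sees-at-most-one y-outside
    ... | kx , x-misses | ky , y-misses with fresh (kx ∷ ky ∷ []) 2<1+m
    ...   | r , r≢kx ∷ r≢ky ∷ [] with fresh (kx ∷ ky ∷ r ∷ []) 3<1+m
    ...     | s , s≢kx ∷ s≢ky ∷ s≢r ∷ [] = ¬-not λ xy → twoK2-free (twoK2-copy xy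
              (q-adjacent r s (≢-sym s≢r))
              (x-misses r r≢kx) (x-misses s s≢kx) (y-misses r r≢ky) (y-misses s s≢ky))

    seesAllBut-some? : ∀ x → Dec (∃ λ i → SeesAllBut C i x)
    seesAllBut-some? x = Fin.any? λ i → seesAllBut? C i x

    partOf : ∀ {x} → Dec (∃ λ i → SeesAllBut C i x) → Fin 4
    partOf (yes (zero  , _)) = 1F
    partOf (yes (suc _ , _)) = 0F
    partOf (no _)            = 2F

    part : V → Fin 4
    part x = partOf (seesAllBut-some? x)

    InPart : Fin 4 → V → Set
    InPart 0F x = ∃ λ i → SeesAllBut C (suc i) x
    InPart 1F x = SeesAllBut C zero x
    InPart 2F x = ∀ i → ¬ SeesAllBut C i x
    InPart 3F x = ⊥

    partOf-sound : ∀ {x} (found : Dec (∃ λ i → SeesAllBut C i x)) → InPart (partOf found) x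
    partOf-sound (yes (zero  , x-sees)) = x-sees
    partOf-sound (yes (suc i , x-sees)) = i , x-sees
    partOf-sound (no ¬x-sees)           = λ i x-sees → ¬x-sees (i , x-sees)

    inPart : ∀ {x k} → part x ≡ k → InPart k x
    inPart {x} refl = partOf-sound (seesAllBut-some? x)

    part₀-sees-q₀ : ∀ v → part v ≡ 0F → E v (q zero) ≡ true
    part₀-sees-q₀ v v∈ = let _ , v-sees = inPart v∈ in v-sees zero (λ ())

    part₀-nonadjacency-transitive : ∀ {x y z} → part x ≡ 0F → part y ≡ 0F → part z ≡ 0F →
      E x z ≡ false → E z y ≡ false → E x y ≡ false
    part₀-nonadjacency-transitive {y = y} x∈ y∈ z∈ xz zy =
      let _ , x-sees = inPart x∈; _ , y-sees = inPart y∈; _ , z-sees = inPart z∈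
          x∼z = nonadjacent⇒same-index x-sees z-sees xz
          z∼y = nonadjacent⇒same-index z-sees y-sees zy
      in seesAllBut-independent x-sees (subst (λ l → SeesAllBut C l y) (sym (trans x∼z z∼y)) y-sees)

    independent : ∀ i → i ≢ 0F → Independent G (λ v → part v ≡ i)
    independent 0F 0≢0 = contradiction refl 0≢0
    independent 1F _ _ _ x∈ y∈ = seesAllBut-independent (inPart x∈) (inPart y∈)
    independent 2F _ _ _ x∈ y∈ = outside-independent (inPart x∈) (inPart y∈)
    independent 3F _ _ _ x∈ _  = ⊥-elim (inPart x∈)

    result : Decomposition G
    result = decomposition twoK2-free part (q zero) part₀-sees-q₀
      (nonadjacency-transitive⇒paw-free _ part₀-nonadjacency-transitive) independent

theorem3p8 : (G : Graph) → Connected G → Free G twoK2 → Free G HVN →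
    Free G twoK2 × Free G diamond ⊎
    Σ (Fin (n G) → Fin 4) (λ p →
    (FreeIn G (λ v → p v ≡ Fin.zero) twoK2 ×
    FreeIn G (λ v → p v ≡ Fin.zero) paw ×
    (∀ w1 w → IsCliqueNumberIn G (λ v → p v ≡ Fin.zero) w1 →
    IsCliqueNumber G w → w1 ≤ w ∸ 1)) ×
    (∀ (i : Fin 4) → i ≢ Fin.zero → Independent G (λ v → p v ≡ i)))
theorem3p8 G _ twoK2-free HVN-free with K4? G
... | yes k4 with extendToNonAugmentable G (K4⇒clique G k4)
...   | _ , s≤s 3≤m , C , ¬augmentable =
        inj₂ (CliqueCase.result G twoK2-free HVN-free 3≤m C ¬augmentable)
theorem3p8 G _ twoK2-free HVN-free | no ¬K4 with triangle? G
... | yes (a , b , d , ab , ad , bd) = inj₂ (K4FreeCase.result G twoK2-free ¬K4 ab ad bd)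
... | no ¬triangle = inj₁ (twoK2-free , triangle-free⇒diamond-free G ¬triangle)
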